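{- Let $P:\mathcal{C}^{op}\to\mathbf{InfSL}$ be an m-variational existential doctrine with a strong predicate classifier. Then the comprehension arrows of $P$ are exactly the strong monomorphisms of $\mathcal{C}$: an arrow $m:X\to A$ is a strong monomorphism if and only if it is isomorphic over $A$ to $\{\alpha\}$ for some $\alpha\in P(A)$.
   Context: A primary doctrine is a functor $P:\mathcal{C}^{op}\to\mathbf{InfSL}$, $\mathcal{C}$ with finite products, $\mathbf{InfSL}$ the category of inf-semilattices and meet-preserving maps; $P_f=P(f)$, $\top_A$ the top of $P(A)$. $P$ is elementary if for each $A$ there is $\delta_A\in P(A\times A)$ such that for every $X$ the map $\alpha\mapsto P_{\langle pr_1,pr_2\rangle}(\alpha)\wedge P_{\langle pr_2,pr_3\rangle}(\delta_A)$, $P(X\times A)\to P(X\times A\times A)$, is left adjoint to $P_{\langle pr_1,pr_2,pr_2\rangle}$. $P$ is existential if each $P_{pr}$ along a product projection has a left adjoint satisfying Beck–Chevalley and Frobenius reciprocity. $P$ has comprehensive diagonals if for $f,g:X\to A$: $f=g$ iff $\top_X=P_{\langle f,g\rangle}(\delta_A)$. $P$ has weak comprehension if for each $\alpha\in P(A)$ there is $\{\alpha\}:X\to A$ (its comprehension arrow) with $\top_X=P_{\{\alpha\}}(\alpha)$ through which every $f:Y\to A$ with $\top_Y\le P_f(\alpha)$ factors; comprehension is strong if the factorization is always unique and full if $\alpha\le\beta$ iff $\top_X\le P_{\{\alpha\}}(\beta)$. $P$ is m-variational if it is elementary with comprehensive diagonals and full strong comprehension. A strong predicate classifier is an object $\Omega$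 with $\in\ \in P(\Omega)$ such that for each $\phi\in P(A)$ there is a unique $\chi:A\to\Omega$ with $P_\chi(\in)=\phi$. -}

module Defs where

open import Level using (Level; _⊔_) renaming (suc to lsuc)
open import Data.Product using (Σ; Σ-syntax; _×_; _,_)
open import Relation.Binary.PropositionalEquality using (_≡_)
open import Relation.Binary.Lattice using (IsBoundedMeetSemilattice)

record Category (o h : Level) : Set (lsuc (o ⊔ h)) where
  infixr 9 _∘_
  field
    Obj : Set o
    Hom : Obj → Obj → Set h
    id  : ∀ {A} → Hom A A
    _∘_ : ∀ {A B C} → Hom B C → Hom A B → Hom A C
    identityˡ : ∀ {A B} (f : Hom A B) → id ∘ f ≡ f
    identityʳ : ∀ {A B} (f : Hom A B) → f ∘ id ≡ f
    assoc : ∀ {A B C D} (f : Hom A B) (g : Hom B C) (k : Hom C D) →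
            (k ∘ g) ∘ f ≡ k ∘ (g ∘ f)

module _ {o h} (C : Category o h) where
  open Category C

  record FinProducts : Set (o ⊔ h) where
    infixr 7 _⊗_
    field
      𝟙 : Obj
      ! : ∀ {A} → Hom A 𝟙
      !-unique : ∀ {A} (f : Hom A 𝟙) → f ≡ !
      _⊗_ : Obj → Obj → Obj
      π₁ : ∀ {A B} → Hom (A ⊗ B) A
      π₂ : ∀ {A B} → Hom (A ⊗ B) B
      ⟨_,_⟩ : ∀ {X A B} → Hom X A → Hom X B → Hom X (A ⊗ B)
      π₁-⟨⟩ : ∀ {X A B} (f : Hom X A) (g : Hom X B) → π₁ ∘ ⟨ f , g ⟩ ≡ f
      π₂-⟨⟩ : ∀ {X A B} (f : Hom X A) (g : Hom X B) → π₂ ∘ ⟨ f , g ⟩ ≡ g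
      ⟨⟩-unique : ∀ {X A B} (f : Hom X A) (g : Hom X B) (k : Hom X (A ⊗ B)) →
                  π₁ ∘ k ≡ f → π₂ ∘ k ≡ g → k ≡ ⟨ f , g ⟩

  Mono : ∀ {X A} → Hom X A → Set (o ⊔ h)
  Mono {X} m = ∀ {Z} (g k : Hom Z X) → m ∘ g ≡ m ∘ k → g ≡ k

  Epi : ∀ {B C} → Hom B C → Set (o ⊔ h)
  Epi {B} {C} e = ∀ {Z} (g k : Hom C Z) → g ∘ e ≡ k ∘ e → g ≡ k

  StrongMono : ∀ {X A} → Hom X A → Set (o ⊔ h)
  StrongMono {X} {A} m =
    Mono m ×
    (∀ {B D} (e : Hom B D) → Epi e → (f : Hom B X) (g : Hom D A) →
       m ∘ f ≡ g ∘ e → Σ[ d ∈ Hom D X ] (d ∘ e ≡ f × m ∘ d ≡ g))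

  IsoOver : ∀ {X Y A} → Hom X A → Hom Y A → Set h
  IsoOver {X} {Y} m n =
    Σ[ i ∈ Hom X Y ] Σ[ j ∈ Hom Y X ]
      (j ∘ i ≡ id × i ∘ j ≡ id × n ∘ i ≡ m)

record PrimaryDoctrine {o h} (C : Category o h) (FP : FinProducts C) (p ℓ : Level)
       : Set (o ⊔ h ⊔ lsuc (p ⊔ ℓ)) where
  open Category C
  field
    Pred : Obj → Set p
    _≤_ : ∀ {A} → Pred A → Pred A → Set ℓ
    _∧_ : ∀ {A} → Pred A → Pred A → Pred A
    ⊤ : ∀ {A} → Pred A
    isInfSL : ∀ A → IsBoundedMeetSemilattice _≡_ (_≤_ {A}) _∧_ ⊤
    _* : ∀ {A B} → Hom B A → Pred A → Pred B
    *-∧ : ∀ {A B} (f : Hom B A) (α β : Pred A) → (f *) (α ∧ β) ≡ (f *) α ∧ (f *) β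
    *-⊤ : ∀ {A B} (f : Hom B A) → (f *) ⊤ ≡ ⊤
    *-id : ∀ {A} (α : Pred A) → (id *) α ≡ α
    *-∘ : ∀ {A B D} (g : Hom B A) (f : Hom D B) (α : Pred A) →
          ((g ∘ f) *) α ≡ (f *) ((g *) α)

module _ {o h p ℓ} {C : Category o h} {FP : FinProducts C}
         (P : PrimaryDoctrine C FP p ℓ) where
  open Category C
  open FinProducts FP
  open PrimaryDoctrine P

  -- elementary structure; X × A × A is read as (X ⊗ A) ⊗ A
  record Elementary : Set (o ⊔ h ⊔ p ⊔ ℓ) where
    field
      δ : ∀ A → Pred (A ⊗ A)
      elem : ∀ {X A} (α : Pred (X ⊗ A)) (β : Pred ((X ⊗ A) ⊗ A)) →
        let pr₁ = π₁ ∘ π₁ ; pr₂ = π₂ ∘ π₁ ; pr₃ = π₂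
            L = (⟨ pr₁ , pr₂ ⟩ *) α ∧ (⟨ pr₂ , pr₃ ⟩ *) (δ A)
            Δ : Hom (X ⊗ A) ((X ⊗ A) ⊗ A)
            Δ = ⟨ ⟨ π₁ , π₂ ⟩ , π₂ ⟩
        in (L ≤ β → α ≤ (Δ *) β) × (α ≤ (Δ *) β → L ≤ β)

  record Existential : Set (o ⊔ h ⊔ p ⊔ ℓ) where
    field
      ∃₁ : ∀ {A B} → Pred (A ⊗ B) → Pred A
      ∃₁-adj : ∀ {A B} (α : Pred (A ⊗ B)) (β : Pred A) →
               (∃₁ α ≤ β → α ≤ (π₁ *) β) × (α ≤ (π₁ *) β → ∃₁ α ≤ β)
      ∃₁-BC : ∀ {A B Y} (f : Hom Y A) (α : Pred (A ⊗ B)) →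
              (f *) (∃₁ α) ≡ ∃₁ ((⟨ f ∘ π₁ , π₂ ⟩ *) α)
      ∃₁-Frob : ∀ {A B} (α : Pred (A ⊗ B)) (β : Pred A) →
                ∃₁ ((π₁ *) β ∧ α) ≡ β ∧ ∃₁ α
      ∃₂ : ∀ {A B} → Pred (A ⊗ B) → Pred B
      ∃₂-adj : ∀ {A B} (α : Pred (A ⊗ B)) (β : Pred B) →
               (∃₂ α ≤ β → α ≤ (π₂ *) β) × (α ≤ (π₂ *) β → ∃₂ α ≤ β)
      ∃₂-BC : ∀ {A B Y} (f : Hom Y B) (α : Pred (A ⊗ B)) →
              (f *) (∃₂ α) ≡ ∃₂ ((⟨ π₁ , f ∘ π₂ ⟩ *) α)
      ∃₂-Frob : ∀ {A B} (α : Pred (A ⊗ B)) (β : Pred B) →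
                ∃₂ ((π₂ *) β ∧ α) ≡ β ∧ ∃₂ α

  ComprehensiveDiagonals : Elementary → Set (o ⊔ h ⊔ p)
  ComprehensiveDiagonals E =
    ∀ {X A} (f g : Hom X A) →
      (f ≡ g → ⊤ ≡ (⟨ f , g ⟩ *) (Elementary.δ E A)) ×
      (⊤ ≡ (⟨ f , g ⟩ *) (Elementary.δ E A) → f ≡ g)

  record WeakComprehension : Set (o ⊔ h ⊔ p ⊔ ℓ) where
    field
      Cmp : ∀ {A} → Pred A → Obj
      cmp : ∀ {A} (α : Pred A) → Hom (Cmp α) A
      cmp-⊤ : ∀ {A} (α : Pred A) → ⊤ ≡ (cmp α *) α
      factor : ∀ {A Y} (α : Pred A) (f : Hom Y A) → ⊤ ≤ (f *) α →
               Σ[ k ∈ Hom Y (Cmp α) ] (cmp α ∘ k ≡ f)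

  module _ (W : WeakComprehension) where
    open WeakComprehension W

    StrongComprehension : Set (o ⊔ h ⊔ p ⊔ ℓ)
    StrongComprehension =
      ∀ {A Y} (α : Pred A) (f : Hom Y A) → ⊤ ≤ (f *) α →
        (k k′ : Hom Y (Cmp α)) → cmp α ∘ k ≡ f → cmp α ∘ k′ ≡ f → k ≡ k′

    FullComprehension : Set (o ⊔ p ⊔ ℓ)
    FullComprehension =
      ∀ {A} (α β : Pred A) → (α ≤ β → ⊤ ≤ (cmp α *) β) × (⊤ ≤ (cmp α *) β → α ≤ β)

  record MVariational : Set (o ⊔ h ⊔ p ⊔ ℓ) where
    field
      elementary : Elementary
      comprehensiveDiagonals : ComprehensiveDiagonals elementary
      comprehension : WeakComprehension
      strong : StrongComprehension comprehension
      full : FullComprehension comprehension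

  record StrongPredicateClassifier : Set (o ⊔ h ⊔ p) where
    field
      Ω : Obj
      ∈ : Pred Ω
      χ : ∀ {A} → Pred A → Hom A Ω
      χ-classifies : ∀ {A} (φ : Pred A) → (χ φ *) ∈ ≡ φ
      χ-unique : ∀ {A} (φ : Pred A) (g : Hom A Ω) → (g *) ∈ ≡ φ → g ≡ χ φ

{-# OPTIONS --safe #-}
-- A comprehension arrow {α} is mono by uniqueness of factorisations, and the
-- classifier makes every epi e reflect ⊤ (χ φ ∘ e = χ ⊤ ∘ e forces χ φ = χ ⊤), so a
-- square from an epi to {α} has its bottom arrow landing in α, which yields the
-- diagonal. Conversely a strong mono m factors as m = {α} ∘ k with α = ∃_m ⊤ its image.
-- For any mono c, full comprehension and comprehensive diagonals give c* ∃_c β ≤ β.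
-- So ⊤ ≤ k* β gives α ≤ ∃_{α} β, i.e. ⊤ ≤ {α}* ∃_{α} β ≤ β: k reflects ⊤, hence is
-- epi by comprehensive diagonals, and the fill-in for m inverts k.
module Submission where

open import Level using (_⊔_)
open import Defs
open import Data.Product using (Σ-syntax; _×_; _,_; proj₁; proj₂)
open import Relation.Binary.Lattice.Bundles using (MeetSemilattice)
open import Relation.Binary.Lattice.Structures using (IsBoundedMeetSemilattice)
open import Relation.Binary.Lattice.Properties.MeetSemilattice using (∧-monotonic)
open import Relation.Binary.PropositionalEquality
  using (_≡_; refl; sym; trans; cong; cong₂; subst; module ≡-Reasoning)
import Relation.Binary.Reasoning.PartialOrder as PosetReasoning

module CategoryProperties {o h} (C : Category o h) where
  open Category C

  section⇒Mono : ∀ {X Y} {i : Hom X Y} {j : Hom Y X} → j ∘ i ≡ id → Mono C i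
  section⇒Mono {i = i} {j} j∘i≡id g k i∘g≡i∘k = begin
    g            ≡⟨ identityˡ g ⟨
    id ∘ g       ≡⟨ cong (_∘ g) j∘i≡id ⟨
    (j ∘ i) ∘ g  ≡⟨ assoc g i j ⟩
    j ∘ (i ∘ g)  ≡⟨ cong (j ∘_) i∘g≡i∘k ⟩
    j ∘ (i ∘ k)  ≡⟨ assoc k i j ⟨
    (j ∘ i) ∘ k  ≡⟨ cong (_∘ k) j∘i≡id ⟩
    id ∘ k       ≡⟨ identityˡ k ⟩
    k            ∎
    where open ≡-Reasoning

  Mono-∘ : ∀ {X Y A} {n : Hom Y A} {i : Hom X Y} → Mono C n → Mono C i → Mono C (n ∘ i)
  Mono-∘ {n = n} {i} n-mono i-mono g k n∘i∘g≡n∘i∘k =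
    i-mono g k (n-mono (i ∘ g) (i ∘ k)
      (trans (sym (assoc g i n)) (trans n∘i∘g≡n∘i∘k (assoc k i n))))

  StrongMono-resp-IsoOver : ∀ {X Y A} {m : Hom X A} {n : Hom Y A} →
    IsoOver C m n → StrongMono C n → StrongMono C m
  StrongMono-resp-IsoOver {m = m} {n} (i , j , j∘i≡id , i∘j≡id , n∘i≡m) (n-mono , n-fill) =
    subst (Mono C) n∘i≡m (Mono-∘ n-mono (section⇒Mono j∘i≡id)) , fill
    where
      fill : ∀ {B D} (e : Hom B D) → Epi C e → (f : Hom B _) (g : Hom D _) →
             m ∘ f ≡ g ∘ e → Σ[ d ∈ Hom D _ ] (d ∘ e ≡ f × m ∘ d ≡ g)
      fill e e-epi f g m∘f≡g∘e =
        let d , d∘e≡i∘f , n∘d≡g = n-fill e e-epi (i ∘ f) g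
              (trans (sym (assoc f i n)) (trans (cong (_∘ f) n∘i≡m) m∘f≡g∘e))
        in j ∘ d ,
           (begin
             (j ∘ d) ∘ e  ≡⟨ assoc e d j ⟩
             j ∘ (d ∘ e)  ≡⟨ cong (j ∘_) d∘e≡i∘f ⟩
             j ∘ (i ∘ f)  ≡⟨ assoc f i j ⟨
             (j ∘ i) ∘ f  ≡⟨ cong (_∘ f) j∘i≡id ⟩
             id ∘ f       ≡⟨ identityˡ f ⟩
             f            ∎) ,
           (begin
             m ∘ (j ∘ d)        ≡⟨ cong (_∘ (j ∘ d)) n∘i≡m ⟨
             (n ∘ i) ∘ (j ∘ d)  ≡⟨ assoc (j ∘ d) i n ⟩
             n ∘ (i ∘ (j ∘ d))  ≡⟨ cong (n ∘_) (assoc d j i) ⟨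
             n ∘ ((i ∘ j) ∘ d)  ≡⟨ cong (λ x → n ∘ (x ∘ d)) i∘j≡id ⟩
             n ∘ (id ∘ d)       ≡⟨ cong (n ∘_) (identityˡ d) ⟩
             n ∘ d              ≡⟨ n∘d≡g ⟩
             g                  ∎)
        where open ≡-Reasoning

  StrongMono-factor-epi⇒IsoOver : ∀ {X Y A} {m : Hom X A} {c : Hom Y A} {k : Hom X Y} →
    StrongMono C m → Mono C c → Epi C k → c ∘ k ≡ m → IsoOver C m c
  StrongMono-factor-epi⇒IsoOver {m = m} {c} {k} (_ , m-fill) c-mono k-epi c∘k≡m =
    k , d , d∘k≡id , c-mono (k ∘ d) id c∘k∘d≡c∘id , c∘k≡m
    where
      diagonal = m-fill k k-epi id c (trans (identityʳ m) (sym c∘k≡m))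
      d = proj₁ diagonal
      d∘k≡id = proj₁ (proj₂ diagonal)
      c∘k∘d≡c∘id : c ∘ (k ∘ d) ≡ c ∘ id
      c∘k∘d≡c∘id = begin
        c ∘ (k ∘ d)  ≡⟨ assoc d k c ⟨
        (c ∘ k) ∘ d  ≡⟨ cong (_∘ d) c∘k≡m ⟩
        m ∘ d        ≡⟨ proj₂ (proj₂ diagonal) ⟩
        c            ≡⟨ identityʳ c ⟨
        c ∘ id       ∎
        where open ≡-Reasoning

module ProductProperties {o h} {C : Category o h} (FP : FinProducts C) where
  open Category C
  open FinProducts FP

  ⟨⟩∘ : ∀ {X Y A B} (f : Hom Y A) (g : Hom Y B) (k : Hom X Y) →
        ⟨ f , g ⟩ ∘ k ≡ ⟨ f ∘ k , g ∘ k ⟩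
  ⟨⟩∘ f g k = ⟨⟩-unique (f ∘ k) (g ∘ k) (⟨ f , g ⟩ ∘ k)
    (trans (sym (assoc k ⟨ f , g ⟩ π₁)) (cong (_∘ k) (π₁-⟨⟩ f g)))
    (trans (sym (assoc k ⟨ f , g ⟩ π₂)) (cong (_∘ k) (π₂-⟨⟩ f g)))

  ⟨⟩-η : ∀ {X A B} (k : Hom X (A ⊗ B)) → k ≡ ⟨ π₁ ∘ k , π₂ ∘ k ⟩
  ⟨⟩-η k = ⟨⟩-unique (π₁ ∘ k) (π₂ ∘ k) k refl refl

  first : ∀ {A B Z} → Hom A B → Hom (A ⊗ Z) (B ⊗ Z)
  first f = ⟨ f ∘ π₁ , π₂ ⟩

  second : ∀ {A B Z} → Hom A B → Hom (Z ⊗ A) (Z ⊗ B)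
  second f = ⟨ π₁ , f ∘ π₂ ⟩

  first∘⟨⟩ : ∀ {X A B Z} (f : Hom A B) (a : Hom X A) (z : Hom X Z) →
             first f ∘ ⟨ a , z ⟩ ≡ ⟨ f ∘ a , z ⟩
  first∘⟨⟩ f a z = trans (⟨⟩∘ (f ∘ π₁) π₂ ⟨ a , z ⟩)
    (cong₂ ⟨_,_⟩ (trans (assoc ⟨ a , z ⟩ π₁ f) (cong (f ∘_) (π₁-⟨⟩ a z))) (π₂-⟨⟩ a z))

  second∘⟨⟩ : ∀ {X A B Z} (f : Hom A B) (z : Hom X Z) (a : Hom X A) →
              second f ∘ ⟨ z , a ⟩ ≡ ⟨ z , f ∘ a ⟩
  second∘⟨⟩ f z a = trans (⟨⟩∘ π₁ (f ∘ π₂) ⟨ z , a ⟩)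
    (cong₂ ⟨_,_⟩ (π₁-⟨⟩ z a) (trans (assoc ⟨ z , a ⟩ π₂ f) (cong (f ∘_) (π₂-⟨⟩ z a))))

  first-∘ : ∀ {A B D Z} {c : Hom B D} {k : Hom A B} {m : Hom A D} →
            c ∘ k ≡ m → first {Z = Z} c ∘ first k ≡ first m
  first-∘ {c = c} {k} c∘k≡m = trans (first∘⟨⟩ c (k ∘ π₁) π₂)
    (cong ⟨_, π₂ ⟩ (trans (sym (assoc π₁ k c)) (cong (_∘ π₁) c∘k≡m)))

  first∘second : ∀ {X A B A′ B′} (f : Hom A A′) (g : Hom B B′) (z : Hom X (A ⊗ B)) →
                 first f ∘ (second g ∘ z) ≡ ⟨ f ∘ (π₁ ∘ z) , g ∘ (π₂ ∘ z) ⟩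
  first∘second f g z = begin
    first f ∘ (second g ∘ z)                        ≡⟨ cong (λ w → first f ∘ (second g ∘ w)) (⟨⟩-η z) ⟩
    first f ∘ (second g ∘ ⟨ π₁ ∘ z , π₂ ∘ z ⟩)      ≡⟨ cong (first f ∘_) (second∘⟨⟩ g (π₁ ∘ z) (π₂ ∘ z)) ⟩
    first f ∘ ⟨ π₁ ∘ z , g ∘ (π₂ ∘ z) ⟩             ≡⟨ first∘⟨⟩ f (π₁ ∘ z) (g ∘ (π₂ ∘ z)) ⟩
    ⟨ f ∘ (π₁ ∘ z) , g ∘ (π₂ ∘ z) ⟩                 ∎
    where open ≡-Reasoning

module DoctrineProperties {o h p ℓ} {C : Category o h} {FP : FinProducts C}
                          (P : PrimaryDoctrine C FP p ℓ) where
  open Category C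
  open FinProducts FP
  open PrimaryDoctrine P
  open CategoryProperties C
  open ProductProperties FP

  meetSemilattice : Obj → MeetSemilattice p p ℓ
  meetSemilattice A = record
    { isMeetSemilattice = IsBoundedMeetSemilattice.isMeetSemilattice (isInfSL A) }

  module InfSL {A : Obj} = IsBoundedMeetSemilattice (isInfSL A)
  module ≤-Reasoning {A : Obj} = PosetReasoning (MeetSemilattice.poset (meetSemilattice A))
  open InfSL using (reflexive; antisym; maximum; x∧y≤x; x∧y≤y; ∧-greatest)
    renaming (refl to ≤-refl; trans to ≤-trans)

  ⊤≤⇒⊤≡ : ∀ {A} {α : Pred A} → ⊤ ≤ α → ⊤ ≡ α
  ⊤≤⇒⊤≡ {α = α} ⊤≤α = antisym ⊤≤α (maximum α)

  ⊤≤-∧ : ∀ {A} {α β : Pred A} → ⊤ ≤ (α ∧ β) → ⊤ ≤ α × ⊤ ≤ β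
  ⊤≤-∧ ⊤≤α∧β = ≤-trans ⊤≤α∧β (x∧y≤x _ _) , ≤-trans ⊤≤α∧β (x∧y≤y _ _)

  *-mono : ∀ {A B} (f : Hom B A) {α β : Pred A} → α ≤ β → (f *) α ≤ (f *) β
  *-mono f {α} {β} α≤β = begin
    (f *) α              ≡⟨ cong (f *) (antisym (∧-greatest ≤-refl α≤β) (x∧y≤x α β)) ⟩
    (f *) (α ∧ β)        ≡⟨ *-∧ f α β ⟩
    (f *) α ∧ (f *) β    ≤⟨ x∧y≤y _ _ ⟩
    (f *) β              ∎
    where open ≤-Reasoning

  *-fuse : ∀ {A B D} {g : Hom B A} {f : Hom D B} {k : Hom D A} →
           g ∘ f ≡ k → (α : Pred A) → (f *) ((g *) α) ≡ (k *) α
  *-fuse {g = g} {f} g∘f≡k α = trans (sym (*-∘ g f α)) (cong (λ w → (w *) α) g∘f≡k)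

  ⊤≤-∘ : ∀ {A B D} {f : Hom B A} (g : Hom D B) {α : Pred A} →
         ⊤ ≤ (f *) α → ⊤ ≤ ((f ∘ g) *) α
  ⊤≤-∘ {f = f} g {α} ⊤≤f*α = begin
    ⊤                  ≡⟨ *-⊤ g ⟨
    (g *) ⊤            ≤⟨ *-mono g ⊤≤f*α ⟩
    (g *) ((f *) α)    ≡⟨ *-∘ f g α ⟨
    ((f ∘ g) *) α      ∎
    where open ≤-Reasoning

  Reflects-⊤ : ∀ {B D} → Hom B D → Set (p ⊔ ℓ)
  Reflects-⊤ {D = D} e = (φ : Pred D) → ⊤ ≤ (e *) φ → ⊤ ≤ φ

  module _ (S : StrongPredicateClassifier P) where
    open StrongPredicateClassifier S

    Epi⇒Reflects-⊤ : ∀ {B D} {e : Hom B D} → Epi C e → Reflects-⊤ e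
    Epi⇒Reflects-⊤ {e = e} e-epi φ ⊤≤e*φ = reflexive (begin
      ⊤            ≡⟨ χ-classifies ⊤ ⟨
      (χ ⊤ *) ∈    ≡⟨ cong (λ g → (g *) ∈) χ⊤≡χφ ⟩
      (χ φ *) ∈    ≡⟨ χ-classifies φ ⟩
      φ            ∎)
      where
        open ≡-Reasoning
        restricts-to-⊤ : (g : Hom _ Ω) → (e *) ((g *) ∈) ≡ ⊤ → g ∘ e ≡ χ ⊤
        restricts-to-⊤ g e*g*∈≡⊤ = χ-unique ⊤ (g ∘ e) (trans (*-∘ g e ∈) e*g*∈≡⊤)
        χ⊤≡χφ : χ ⊤ ≡ χ φ
        χ⊤≡χφ = e-epi (χ ⊤) (χ φ) (trans
          (restricts-to-⊤ (χ ⊤) (trans (cong (e *) (χ-classifies ⊤)) (*-⊤ e)))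
          (sym (restricts-to-⊤ (χ φ) (trans (cong (e *) (χ-classifies φ)) (sym (⊤≤⇒⊤≡ ⊤≤e*φ))))))

  module Comprehension (W : WeakComprehension P) where
    open WeakComprehension W

    ⊤≤-cmp : ∀ {A B} (α : Pred A) (g : Hom B (Cmp α)) → ⊤ ≤ ((cmp α ∘ g) *) α
    ⊤≤-cmp α g = ⊤≤-∘ g (reflexive (cmp-⊤ α))

    ≤-by-points : FullComprehension P W → ∀ {Z} (γ φ : Pred Z) →
      (∀ {Y} (z : Hom Y Z) → ⊤ ≤ (z *) γ → ⊤ ≤ (z *) φ) → γ ≤ φ
    ≤-by-points full γ φ points = proj₂ (full γ φ) (points (cmp γ) (reflexive (cmp-⊤ γ)))

    module _ (strong : StrongComprehension P W) where

      cmp-Mono : ∀ {A} (α : Pred A) → Mono C (cmp α)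
      cmp-Mono α g k cmp∘g≡cmp∘k = strong α (cmp α ∘ g) (⊤≤-cmp α g) g k refl (sym cmp∘g≡cmp∘k)

      cmp-StrongMono : StrongPredicateClassifier P → ∀ {A} (α : Pred A) → StrongMono C (cmp α)
      cmp-StrongMono S α = cmp-Mono α , fill
        where
          fill : ∀ {B D} (e : Hom B D) → Epi C e → (f : Hom B (Cmp α)) (g : Hom D _) →
                 cmp α ∘ f ≡ g ∘ e → Σ[ d ∈ Hom D (Cmp α) ] (d ∘ e ≡ f × cmp α ∘ d ≡ g)
          fill e e-epi f g cmp∘f≡g∘e =
            d , cmp-Mono α (d ∘ e) f cmp∘d∘e≡cmp∘f , cmp∘d≡g
            where
              ⊤≤g*α : ⊤ ≤ (g *) α
              ⊤≤g*α = Epi⇒Reflects-⊤ S e-epi ((g *) α)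
                (≤-trans (⊤≤-cmp α f) (reflexive (sym (*-fuse (sym cmp∘f≡g∘e) α))))
              d = proj₁ (factor α g ⊤≤g*α)
              cmp∘d≡g = proj₂ (factor α g ⊤≤g*α)
              cmp∘d∘e≡cmp∘f : cmp α ∘ (d ∘ e) ≡ cmp α ∘ f
              cmp∘d∘e≡cmp∘f = trans (sym (assoc e d (cmp α)))
                (trans (cong (_∘ e) cmp∘d≡g) (sym cmp∘f≡g∘e))

  module Equality (E : Elementary P) (diagonals : ComprehensiveDiagonals P E) where
    open Elementary E

    ⊤≤δ⇒≡ : ∀ {X A} {f g : Hom X A} → ⊤ ≤ (⟨ f , g ⟩ *) (δ A) → f ≡ g
    ⊤≤δ⇒≡ {f = f} {g} ⊤≤δ = proj₂ (diagonals f g) (⊤≤⇒⊤≡ ⊤≤δ)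

    ≡⇒⊤≤δ : ∀ {X A} {f g : Hom X A} → f ≡ g → ⊤ ≤ (⟨ f , g ⟩ *) (δ A)
    ≡⇒⊤≤δ {f = f} {g} f≡g = reflexive (proj₁ (diagonals f g) f≡g)

    Reflects-⊤⇒Epi : ∀ {B D} {k : Hom B D} → Reflects-⊤ k → Epi C k
    Reflects-⊤⇒Epi {k = k} reflects g g′ g∘k≡g′∘k = ⊤≤δ⇒≡ (reflects _
      (≤-trans (≡⇒⊤≤δ g∘k≡g′∘k) (reflexive (sym (*-fuse (⟨⟩∘ g g′ k) (δ _))))))

    module Images (Ex : Existential P) where
      open Existential Ex

      -- Graph f β is  β(b) ∧ f b = a,  so ∃⟨ f ⟩ β is the direct image ∃_f β of the paper.
      Graph : ∀ {B A} → Hom B A → Pred B → Pred (B ⊗ A)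
      Graph f β = (π₁ *) β ∧ (first f *) (δ _)

      ∃⟨_⟩ : ∀ {B A} → Hom B A → Pred B → Pred A
      ∃⟨ f ⟩ β = ∃₂ (Graph f β)

      ∃₂-unit : ∀ {B A} (ρ : Pred (B ⊗ A)) → ρ ≤ (π₂ *) (∃₂ ρ)
      ∃₂-unit ρ = proj₁ (∃₂-adj ρ (∃₂ ρ)) ≤-refl

      ∃⟨⟩-unit : ∀ {B A} (f : Hom B A) (β : Pred B) → β ≤ (f *) (∃⟨ f ⟩ β)
      ∃⟨⟩-unit f β = begin
        β
          ≤⟨ ∧-greatest ≤-refl (≤-trans (maximum β) (≡⇒⊤≤δ refl)) ⟩
        β ∧ (⟨ f , f ⟩ *) (δ _)
          ≡⟨ cong₂ _∧_ π₁-part first-part ⟨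
        (⟨ id , f ⟩ *) ((π₁ *) β) ∧ (⟨ id , f ⟩ *) ((first f *) (δ _))
          ≡⟨ *-∧ (⟨ id , f ⟩) _ _ ⟨
        (⟨ id , f ⟩ *) (Graph f β)
          ≤⟨ *-mono (⟨ id , f ⟩) (∃₂-unit (Graph f β)) ⟩
        (⟨ id , f ⟩ *) ((π₂ *) (∃⟨ f ⟩ β))
          ≡⟨ *-fuse (π₂-⟨⟩ id f) (∃⟨ f ⟩ β) ⟩
        (f *) (∃⟨ f ⟩ β)
          ∎
        where
          open ≤-Reasoning
          π₁-part = trans (*-fuse (π₁-⟨⟩ id f) β) (*-id β)
          first-part = *-fuse (trans (first∘⟨⟩ f id f) (cong ⟨_, f ⟩ (identityʳ f))) (δ _)

      ∃⟨⟩-factor : ∀ {X Y A} {c : Hom Y A} {k : Hom X Y} {m : Hom X A} (β : Pred X) (γ : Pred Y) →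
                   c ∘ k ≡ m → β ≤ (k *) γ → ∃⟨ m ⟩ β ≤ ∃⟨ c ⟩ γ
      ∃⟨⟩-factor {c = c} {k} {m} β γ c∘k≡m β≤k*γ =
        proj₂ (∃₂-adj (Graph m β) (∃⟨ c ⟩ γ)) (begin
          (π₁ *) β ∧ (first m *) (δ _)
            ≤⟨ ∧-monotonic (meetSemilattice _) (*-mono π₁ β≤k*γ) ≤-refl ⟩
          (π₁ *) ((k *) γ) ∧ (first m *) (δ _)
            ≡⟨ cong₂ _∧_ π₁-part first-part ⟨
          (first k *) ((π₁ *) γ) ∧ (first k *) ((first c *) (δ _))
            ≡⟨ *-∧ (first k) _ _ ⟨
          (first k *) (Graph c γ)
            ≤⟨ *-mono (first k) (∃₂-unit (Graph c γ)) ⟩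
          (first k *) ((π₂ *) (∃⟨ c ⟩ γ))
            ≡⟨ *-fuse (π₂-⟨⟩ _ _) (∃⟨ c ⟩ γ) ⟩
          (π₂ *) (∃⟨ c ⟩ γ)
            ∎)
        where
          open ≤-Reasoning
          π₁-part = trans (*-fuse (π₁-⟨⟩ _ _) γ) (*-∘ k π₁ γ)
          first-part = *-fuse (first-∘ c∘k≡m) (δ _)

      module _ (W : WeakComprehension P) (full : FullComprehension P W) where

        Mono⇒∃⟨⟩-counit : ∀ {B A} {c : Hom B A} → Mono C c → (β : Pred B) → (c *) (∃⟨ c ⟩ β) ≤ β
        Mono⇒∃⟨⟩-counit {c = c} c-mono β =
          ≤-trans (reflexive (∃₂-BC c (Graph c β)))
            (proj₂ (∃₂-adj ψ β) (Comprehension.≤-by-points W full ψ ((π₂ *) β) pointwise))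
          where
            ψ = (second c *) (Graph c β)
            pointwise : ∀ {Y} (z : Hom Y _) → ⊤ ≤ (z *) ψ → ⊤ ≤ (z *) ((π₂ *) β)
            pointwise z ⊤≤z*ψ = begin
              ⊤                    ≤⟨ proj₁ ⊤≤parts ⟩
              ((π₁ ∘ z) *) β       ≡⟨ cong (λ w → (w *) β) π₁∘z≡π₂∘z ⟩
              ((π₂ ∘ z) *) β       ≡⟨ *-∘ π₂ z β ⟩
              (z *) ((π₂ *) β)     ∎
              where
                open ≤-Reasoning
                z*ψ≡ : (z *) ψ ≡ ((π₁ ∘ z) *) β ∧ (⟨ c ∘ (π₁ ∘ z) , c ∘ (π₂ ∘ z) ⟩ *) (δ _)
                z*ψ≡ = trans (*-fuse refl (Graph c β)) (trans (*-∧ (second c ∘ z) _ _)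
                  (cong₂ _∧_ (*-fuse (trans (sym (assoc z (second c) π₁)) (cong (_∘ z) (π₁-⟨⟩ _ _))) β)
                             (*-fuse (first∘second c c z) (δ _))))
                ⊤≤parts = ⊤≤-∧ (≤-trans ⊤≤z*ψ (reflexive z*ψ≡))
                π₁∘z≡π₂∘z = c-mono _ _ (⊤≤δ⇒≡ (proj₂ ⊤≤parts))

  module Proposition (V : MVariational P) (Ex : Existential P) (S : StrongPredicateClassifier P) where
    open MVariational V
    open WeakComprehension comprehension
    open Comprehension comprehension
    open Equality elementary comprehensiveDiagonals
    open Images Ex

    IsoOver-cmp⇒StrongMono : ∀ {X A} {m : Hom X A} →
      Σ[ α ∈ Pred A ] IsoOver C m (cmp α) → StrongMono C m
    IsoOver-cmp⇒StrongMono (α , m≅cmp) = StrongMono-resp-IsoOver m≅cmp (cmp-StrongMono strong S α)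

    StrongMono⇒IsoOver-cmp : ∀ {X A} {m : Hom X A} →
      StrongMono C m → Σ[ α ∈ Pred A ] IsoOver C m (cmp α)
    StrongMono⇒IsoOver-cmp {m = m} m-strong =
      α , StrongMono-factor-epi⇒IsoOver m-strong (cmp-Mono strong α) (Reflects-⊤⇒Epi k-reflects) cmp∘k≡m
      where
        α = ∃⟨ m ⟩ ⊤
        k = proj₁ (factor α m (∃⟨⟩-unit m ⊤))
        cmp∘k≡m = proj₂ (factor α m (∃⟨⟩-unit m ⊤))
        k-reflects : Reflects-⊤ k
        k-reflects β ⊤≤k*β = begin
          ⊤                           ≤⟨ proj₁ (full α (∃⟨ cmp α ⟩ β)) (∃⟨⟩-factor ⊤ β cmp∘k≡m ⊤≤k*β) ⟩
          (cmp α *) (∃⟨ cmp α ⟩ β)    ≤⟨ Mono⇒∃⟨⟩-counit comprehension full (cmp-Mono strong α) β ⟩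
          β                           ∎
          where open ≤-Reasoning

proposition7p27 : ∀ {o h p ℓ} (C : Category o h) (FP : FinProducts C)
    (P : PrimaryDoctrine C FP p ℓ) (V : MVariational P) → Existential P →
    StrongPredicateClassifier P →
    ∀ {X A} (m : Category.Hom C X A) →
      (StrongMono C m →
        Σ[ α ∈ PrimaryDoctrine.Pred P A ]
          IsoOver C m (WeakComprehension.cmp (MVariational.comprehension V) α))
      × ((Σ[ α ∈ PrimaryDoctrine.Pred P A ]
          IsoOver C m (WeakComprehension.cmp (MVariational.comprehension V) α))
        → StrongMono C m)
proposition7p27 C FP P V E S m = StrongMono⇒IsoOver-cmp , IsoOver-cmp⇒StrongMono
  where open DoctrineProperties.Proposition P V E S
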